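{- Let $\alpha=(\alpha_1,\dots,\alpha_m)$ be a sequence of integers and $\beta$ a composition. Then \[M_\beta^\perp\,\mathfrak{S}_\alpha=\sum_\gamma\mathfrak{S}_\gamma,\] where the sum is over all sequences of integers $\gamma=(\gamma_1,\dots,\gamma_m)$ of length $m$ such that removing the zero entries from the sequence $\alpha-\gamma=(\alpha_1-\gamma_1,\dots,\alpha_m-\gamma_m)$ yields the composition $\beta$.
   Context: $\mathsf{NSym}$ is the free associative (non-commutative) algebra over $\mathbb{Q}$ generated by $H_1,H_2,\dots$, with $H_0=1$, $H_i=0$ for $i<0$, and $\{H_\alpha=H_{\alpha_1}\cdots H_{\alpha_m}\}$ over compositions $\alpha$ (finite sequences of positive integers) a basis. For $\alpha\in\mathbb{Z}^m$, $\mathfrak{S}_\alpha=\sum_{\sigma\in S_m}\operatorname{sgn}(\sigma)H_{\alpha_1+\sigma(1)-1,\dots,\alpha_m+\sigma(m)-m}$ (with $\mathfrak{S}_{()}=1$). $\mathsf{QSym}$ is the subring of $\mathbb{Q}[[x_1,x_2,\dots]]$ spanned by the monomial quasi-symmetric functions $M_\alpha=\sum_{i_1<\dots<i_m}x_{i_1}^{\alpha_1}\cdots x_{i_m}^{\alpha_m}$ ($\alpha$ a composition). There is a bilinear pairing $\langle\cdot,\cdot\rangle:\mathsf{NSym}\times\mathsf{QSym}\to\mathbb{Q}$ with $\langle H_\alpha,M_\beta\rangle=\delta_{\alpha,\beta}$. For $G\in\mathsf{QSym}$, $G^\perp:\mathsf{NSym}\to\mathsf{NSym}$ is the linear operator adjoint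 to multiplication by $G$, i.e. $\langle G^\perp F,K\rangle=\langle F,GK\rangle$ for all $F\in\mathsf{NSym}$, $K\in\mathsf{QSym}$. -}

module Defs where

open import Data.Nat as ℕ using (ℕ; zero; suc; _>_; _<ᵇ_)
open import Data.Integer as ℤ using (ℤ; +_; -[1+_])
open import Data.Rational as ℚ using (ℚ; 0ℚ; 1ℚ)
open import Data.List using (List; []; _∷_; map; concatMap; concat; upTo; length; zipWith; foldr)
open import Data.List.Properties using (≡-dec)
open import Data.List.Relation.Unary.All using (All)
open import Data.Maybe using (Maybe; just; nothing)
open import Data.Product using (_×_; _,_)
open import Data.Bool using (if_then_else_)
open import Relation.Nullary using (does)

sumℚ : List ℚ → ℚ
sumℚ = foldr ℚ._+_ 0ℚ

IsComposition : List ℕ → Set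
IsComposition = All (_> 0)

dropZerosℕ : List ℕ → List ℕ
dropZerosℕ []           = []
dropZerosℕ (zero  ∷ xs) = dropZerosℕ xs
dropZerosℕ (suc n ∷ xs) = suc n ∷ dropZerosℕ xs

dropZerosℤ : List ℤ → List ℤ
dropZerosℤ []              = []
dropZerosℤ (+ zero ∷ xs)   = dropZerosℤ xs
dropZerosℤ (+ suc n ∷ xs)  = + suc n ∷ dropZerosℤ xs
dropZerosℤ (-[1+ n ] ∷ xs) = -[1+ n ] ∷ dropZerosℤ xs

-- NSym: formal Q-linear combinations of the words H_w, w ∈ ℤ^*.
-- H_w = H_{w_1} ⋯ H_{w_k} with H_0 = 1 and H_i = 0 for i < 0, so a word
-- with a negative entry is 0, and otherwise H_w = H_c where c is w with
-- its zeros removed (a composition).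

NSym : Set
NSym = List (ℚ × List ℤ)

natSeq : List ℤ → Maybe (List ℕ)
natSeq [] = just []
natSeq (+ n ∷ w) with natSeq w
... | just v  = just (n ∷ v)
... | nothing = nothing
natSeq (-[1+ n ] ∷ w) = nothing

wordComp : List ℤ → Maybe (List ℕ)
wordComp w with natSeq w
... | just v  = just (dropZerosℕ v)
... | nothing = nothing

coeffH : NSym → List ℕ → ℚ
coeffH F c = sumℚ (map term F)
  where
  term : ℚ × List ℤ → ℚ
  term (q , w) with wordComp w
  ... | just c' = if does (≡-dec ℕ._≟_ c' c) then q else 0ℚ
  ... | nothing = 0ℚ

-- Formal power series in x_1, x_2, ...: coefficient function on exponent
-- vectors e = (e_1,…,e_k) (meaning x_1^{e_1}⋯x_k^{e_k}, all other
-- exponents zero).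

Series : Set
Series = List ℕ → ℚ

-- M_β = Σ_{i_1<…<i_m} x_{i_1}^{β_1}⋯x_{i_m}^{β_m}: the monomial x^e
-- occurs (with coefficient 1) iff the nonzero exponents of e, in order,
-- form β.
M : List ℕ → Series
M β e = if does (≡-dec ℕ._≟_ (dropZerosℕ e) β) then 1ℚ else 0ℚ

splits : List ℕ → List (List ℕ × List ℕ)
splits [] = ([] , []) ∷ []
splits (n ∷ e) =
  concatMap (λ k → map (λ { (a , b) → (k ∷ a , (n ℕ.∸ k) ∷ b) }) (splits e))
            (upTo (suc n))

_·_ : Series → Series → Series
(f · g) e = sumℚ (map (λ { (a , b) → f a ℚ.* g b }) (splits e))

-- the pairing ⟨F , G⟩ for F ∈ NSym, G ∈ QSym: ⟨H_c , G⟩ is the coefficient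
-- of M_c in G, i.e. the coefficient of x_1^{c_1}⋯x_k^{c_k} in G.
⟨_,_⟩ : NSym → Series → ℚ
⟨ F , G ⟩ = sumℚ (map term F)
  where
  term : ℚ × List ℤ → ℚ
  term (q , w) with wordComp w
  ... | just c  = q ℚ.* G c
  ... | nothing = 0ℚ

-- G^⊥ F, given by its coefficients in the H-basis:
-- the coefficient of H_δ in G^⊥ F is ⟨G^⊥ F , M_δ⟩ = ⟨F , G M_δ⟩.
perpCoeff : Series → NSym → List ℕ → ℚ
perpCoeff G F δ = ⟨ F , G · M δ ⟩

insertAll : ℕ → List ℕ → List (List ℕ)
insertAll x []       = (x ∷ []) ∷ []
insertAll x (y ∷ ys) = (x ∷ y ∷ ys) ∷ map (y ∷_) (insertAll x ys)

perms : ℕ → List (List ℕ)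
perms zero    = [] ∷ []
perms (suc m) = concatMap (insertAll m) (perms m)

countSmaller : ℕ → List ℕ → ℕ
countSmaller x []       = 0
countSmaller x (y ∷ ys) = (if y <ᵇ x then 1 else 0) ℕ.+ countSmaller x ys

inversions : List ℕ → ℕ
inversions []       = 0
inversions (x ∷ xs) = countSmaller x xs ℕ.+ inversions xs

sgn : List ℕ → ℚ
sgn σ = go (inversions σ)
  where
  go : ℕ → ℚ
  go zero    = 1ℚ
  go (suc n) = ℚ.- go n

-- the word (α_1+σ(1)-1, …, α_m+σ(m)-m) (0-based indices: α_i + σ(i) - i)
shiftWord : ℕ → List ℤ → List ℕ → List ℤ
shiftWord i (a ∷ as) (s ∷ ss) = (a ℤ.+ + s ℤ.- + i) ∷ shiftWord (suc i) as ss
shiftWord i _ _ = []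

𝔖 : List ℤ → NSym
𝔖 α = map (λ σ → (sgn σ , shiftWord 0 α σ)) (perms (length α))

sum𝔖 : List (List ℤ) → NSym
sum𝔖 Γ = concat (map 𝔖 Γ)

_⊖_ : List ℤ → List ℤ → List ℤ
_⊖_ = zipWith ℤ._-_

-- Pairing with M_δ reads off the coefficient of H_δ, so both sides are compared through
-- ⟨𝔖_α , M_β M_δ⟩. The heart of the matter is that M_β^⊥ H_w = Σ_b H_{w-b} for every integer
-- word w, summed over the b ∈ ℕ^{|w|} whose nonzero entries form β: both sides of the paired
-- identity satisfy one recursion in the first letter of w, whose exponent goes either entirely
-- to M_δ or partly to the first part of β. Subtracting b commutes with the shifts
-- α_i + σ(i) - i, so M_β^⊥ 𝔖_α = Σ_b 𝔖_{α-b}, and γ = α - b runs exactly once over the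
-- sequences of the statement.

module Submission where

open import Defs
open import Algebra.Bundles using (CommutativeMonoid)
open import Data.Bool using (true; false; if_then_else_)
open import Data.Integer as ℤ using (ℤ; +_; -[1+_])
import Data.Integer.Properties as ℤP
open import Data.Integer.Tactic.RingSolver using (solve-∀)
open import Data.List using (List; []; _∷_; map; concatMap; upTo; applyUpTo; length; _++_)
open import Data.List.Properties using (map-++; map-∘; map-cong; map-cong-local; map-applyUpTo; ∷-injectiveʳ; length-map; map-injective; ≡-dec)
open import Data.List.Membership.Propositional using (_∈_)
open import Data.List.Membership.Propositional.Properties using (∈-map⁺; ∈-map⁻; ∈-++⁺ˡ; ∈-++⁺ʳ; ∈-++⁻)
open import Data.List.Membership.Propositional.Properties.WithK using (unique∧set⇒bag)
open import Data.List.Relation.Binary.BagAndSetEquality using (∼bag⇒↭)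
open import Data.List.Relation.Binary.Permutation.Propositional using (_↭_; ↭⇒↭ₛ)
import Data.List.Relation.Binary.Permutation.Propositional.Properties as ↭
open import Data.List.Relation.Binary.Permutation.Setoid.Properties using (foldr-commMonoid)
open import Data.List.Relation.Unary.All as All using (All; []; _∷_)
import Data.List.Relation.Unary.All.Properties as AllP
open import Data.List.Relation.Unary.AllPairs using ([]; _∷_)
open import Data.List.Relation.Unary.Any using (here)
open import Data.List.Relation.Unary.Unique.Propositional using (Unique)
import Data.List.Relation.Unary.Unique.Propositional.Properties as Unique
open import Data.List.Relation.Binary.Disjoint.Propositional using (Disjoint)
open import Data.Maybe using (Maybe; just; nothing; maybe′)
open import Data.Nat as ℕ using (ℕ; zero; suc; _≡ᵇ_; _<ᵇ_; _∸_)
import Data.Nat.Properties as ℕP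
open import Data.Product as Product using (_×_; _,_; proj₁; proj₂; ∃)
open import Data.Rational as ℚ using (ℚ; 0ℚ; 1ℚ)
import Data.Rational.Properties as ℚP
open import Data.Sum using (inj₁; inj₂)
open import Function using (_∘_)
open import Function.Bundles using (_⇔_; mk⇔)
import Function.Properties.Equivalence as ⇔
open import Relation.Nullary using (does)
open import Relation.Binary.PropositionalEquality

private module ℚ+ = CommutativeMonoid ℚP.+-0-commutativeMonoid
open import Algebra.Properties.CommutativeSemigroup ℚ+.commutativeSemigroup using () renaming (interchange to +-interchange)

sum-++ : ∀ xs ys → sumℚ (xs ++ ys) ≡ sumℚ xs ℚ.+ sumℚ ys
sum-++ [] ys = sym (ℚP.+-identityˡ _)
sum-++ (x ∷ xs) ys = trans (cong (x ℚ.+_) (sum-++ xs ys)) (sym (ℚP.+-assoc x _ _))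

sum-↭ : ∀ {xs ys} → xs ↭ ys → sumℚ xs ≡ sumℚ ys
sum-↭ p = foldr-commMonoid ℚ+.setoid ℚ+.isCommutativeMonoid (↭⇒↭ₛ p)

module _ {A : Set} where

  sum-map-++ : ∀ (f : A → ℚ) xs ys → sumℚ (map f (xs ++ ys)) ≡ sumℚ (map f xs) ℚ.+ sumℚ (map f ys)
  sum-map-++ f xs ys = trans (cong sumℚ (map-++ f xs ys)) (sum-++ (map f xs) (map f ys))

  sum-cong : ∀ {f g : A → ℚ} xs → (∀ x → f x ≡ g x) → sumℚ (map f xs) ≡ sumℚ (map g xs)
  sum-cong xs e = cong sumℚ (map-cong e xs)

  sum-cong-All : ∀ {f g : A → ℚ} {xs} → All (λ x → f x ≡ g x) xs → sumℚ (map f xs) ≡ sumℚ (map g xs)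
  sum-cong-All e = cong sumℚ (map-cong-local e)

  sum-zero : ∀ {f : A → ℚ} xs → (∀ x → f x ≡ 0ℚ) → sumℚ (map f xs) ≡ 0ℚ
  sum-zero [] e = refl
  sum-zero (x ∷ xs) e = trans (cong₂ ℚ._+_ (e x) (sum-zero xs e)) (ℚP.+-identityˡ 0ℚ)

  *-distribˡ-sum : ∀ q (f : A → ℚ) xs → q ℚ.* sumℚ (map f xs) ≡ sumℚ (map (λ x → q ℚ.* f x) xs)
  *-distribˡ-sum q f [] = ℚP.*-zeroʳ q
  *-distribˡ-sum q f (x ∷ xs) = trans (ℚP.*-distribˡ-+ q (f x) _) (cong (q ℚ.* f x ℚ.+_) (*-distribˡ-sum q f xs))

  sum-+ : ∀ (f g : A → ℚ) xs → sumℚ (map (λ x → f x ℚ.+ g x) xs) ≡ sumℚ (map f xs) ℚ.+ sumℚ (map g xs)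
  sum-+ f g []       = sym (ℚP.+-identityˡ 0ℚ)
  sum-+ f g (x ∷ xs) = trans (cong ((f x ℚ.+ g x) ℚ.+_) (sum-+ f g xs)) (+-interchange (f x) (g x) _ _)

  sum-unique-set : ∀ (f : A → ℚ) {xs ys} → Unique xs → Unique ys →
                   (∀ {x} → x ∈ xs ⇔ x ∈ ys) → sumℚ (map f xs) ≡ sumℚ (map f ys)
  sum-unique-set f !xs !ys xs≈ys = sum-↭ (↭.map⁺ f (∼bag⇒↭ (unique∧set⇒bag !xs !ys xs≈ys)))

module _ {A B : Set} where

  sum-map-∘ : ∀ (f : B → ℚ) (g : A → B) xs → sumℚ (map f (map g xs)) ≡ sumℚ (map (f ∘ g) xs)
  sum-map-∘ f g xs = cong sumℚ (sym (map-∘ xs))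

  sum-concatMap : ∀ (f : B → ℚ) (h : A → List B) xs →
    sumℚ (map f (concatMap h xs)) ≡ sumℚ (map (λ x → sumℚ (map f (h x))) xs)
  sum-concatMap f h [] = refl
  sum-concatMap f h (x ∷ xs) =
    trans (sum-map-++ f (h x) (concatMap h xs)) (cong (sumℚ (map f (h x)) ℚ.+_) (sum-concatMap f h xs))

  sum-swap : ∀ (f : A → B → ℚ) xs ys →
    sumℚ (map (λ x → sumℚ (map (f x) ys)) xs) ≡ sumℚ (map (λ y → sumℚ (map (λ x → f x y) xs)) ys)
  sum-swap f [] ys = sym (sum-zero ys (λ _ → refl))
  sum-swap f (x ∷ xs) ys = trans (cong (sumℚ (map (f x) ys) ℚ.+_) (sum-swap f xs ys))
    (sym (sum-+ (f x) (λ y → sumℚ (map (λ x → f x y) xs)) ys))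

sum-applyUpTo-cong : ∀ {f g : ℕ → ℚ} x → (∀ i → f i ≡ g i) → sumℚ (applyUpTo f x) ≡ sumℚ (applyUpTo g x)
sum-applyUpTo-cong zero    e = refl
sum-applyUpTo-cong (suc x) e = cong₂ ℚ._+_ (e 0) (sum-applyUpTo-cong x (e ∘ suc))

sum-applyUpTo-zero : ∀ {f : ℕ → ℚ} x → (∀ i → f i ≡ 0ℚ) → sumℚ (applyUpTo f x) ≡ 0ℚ
sum-applyUpTo-zero zero    e = refl
sum-applyUpTo-zero (suc x) e = trans (cong₂ ℚ._+_ (e 0) (sum-applyUpTo-zero x (e ∘ suc))) (ℚP.+-identityˡ 0ℚ)

sum-applyUpTo-≡ᵇ : ∀ x k (f : ℕ → ℚ) →
  sumℚ (applyUpTo (λ i → if i ≡ᵇ k then f i else 0ℚ) x) ≡ (if x <ᵇ suc k then 0ℚ else f k)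
sum-applyUpTo-≡ᵇ zero    k       f = refl
sum-applyUpTo-≡ᵇ (suc x) zero    f = trans (cong (f 0 ℚ.+_) (sum-applyUpTo-zero x (λ _ → refl))) (ℚP.+-identityʳ (f 0))
sum-applyUpTo-≡ᵇ (suc x) (suc k) f = trans (ℚP.+-identityˡ _) (sum-applyUpTo-≡ᵇ x k (f ∘ suc))

module _ {A : Set} where

  maybe′-cong : ∀ {f g : A → ℚ} m → (∀ a → f a ≡ g a) → maybe′ f 0ℚ m ≡ maybe′ g 0ℚ m
  maybe′-cong (just a) e = e a
  maybe′-cong nothing  e = refl

  maybe′-zero : ∀ {f : A → ℚ} m → (∀ a → f a ≡ 0ℚ) → maybe′ f 0ℚ m ≡ 0ℚ
  maybe′-zero (just a) e = e a
  maybe′-zero nothing  e = refl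

  *-distribˡ-maybe′ : ∀ q (f : A → ℚ) m → q ℚ.* maybe′ f 0ℚ m ≡ maybe′ (λ a → q ℚ.* f a) 0ℚ m
  *-distribˡ-maybe′ q f (just a) = refl
  *-distribˡ-maybe′ q f nothing  = ℚP.*-zeroʳ q

  sum-maybe′ : ∀ {B : Set} (f : B → A → ℚ) m xs →
    sumℚ (map (λ x → maybe′ (f x) 0ℚ m) xs) ≡ maybe′ (λ a → sumℚ (map (λ x → f x a) xs)) 0ℚ m
  sum-maybe′ f (just a) xs = refl
  sum-maybe′ f nothing  xs = sum-zero xs (λ _ → refl)

-- ⟪ w , G ⟫ = ⟨H_w , G⟩ for an integer word w.
⟪_,_⟫ : List ℤ → Series → ℚ
⟪ w , G ⟫ = maybe′ (G ∘ dropZerosℕ) 0ℚ (natSeq w)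

pairTerm : Series → ℚ × List ℤ → ℚ
pairTerm G (q , w) = q ℚ.* ⟪ w , G ⟫

pairing-expand : ∀ F G → ⟨ F , G ⟩ ≡ sumℚ (map (pairTerm G) F)
pairing-expand []            G = refl
pairing-expand ((q , w) ∷ F) G with natSeq w
... | just v  = cong (q ℚ.* G (dropZerosℕ v) ℚ.+_) (pairing-expand F G)
... | nothing = cong₂ ℚ._+_ (sym (ℚP.*-zeroʳ q)) (pairing-expand F G)

dropZerosℕ-idem : ∀ e → dropZerosℕ (dropZerosℕ e) ≡ dropZerosℕ e
dropZerosℕ-idem []          = refl
dropZerosℕ-idem (zero ∷ e)  = dropZerosℕ-idem e
dropZerosℕ-idem (suc n ∷ e) = cong (suc n ∷_) (dropZerosℕ-idem e)

M-dropZerosℕ : ∀ δ e → M δ (dropZerosℕ e) ≡ M δ e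
M-dropZerosℕ δ e = cong (λ c → if does (≡-dec ℕ._≟_ c δ) then 1ℚ else 0ℚ) (dropZerosℕ-idem e)

if-then-else-0ℚ : ∀ b q → (if b then q else 0ℚ) ≡ q ℚ.* (if b then 1ℚ else 0ℚ)
if-then-else-0ℚ true  q = sym (ℚP.*-identityʳ q)
if-then-else-0ℚ false q = sym (ℚP.*-zeroʳ q)

coeffH-expand : ∀ F δ → coeffH F δ ≡ sumℚ (map (pairTerm (M δ)) F)
coeffH-expand []            δ = refl
coeffH-expand ((q , w) ∷ F) δ with natSeq w
... | just v  = cong₂ ℚ._+_ (trans (if-then-else-0ℚ (does (≡-dec ℕ._≟_ (dropZerosℕ v) δ)) q)
                                   (cong (q ℚ.*_) (sym (M-dropZerosℕ δ v))))
                            (coeffH-expand F δ)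
... | nothing = cong₂ ℚ._+_ (sym (ℚP.*-zeroʳ q)) (coeffH-expand F δ)

coeffH≡⟨⟩M : ∀ F δ → coeffH F δ ≡ ⟨ F , M δ ⟩
coeffH≡⟨⟩M F δ = trans (coeffH-expand F δ) (sym (pairing-expand F (M δ)))

⟨⟩-concatMap : ∀ {A : Set} (f : A → NSym) xs G → ⟨ concatMap f xs , G ⟩ ≡ sumℚ (map (λ x → ⟨ f x , G ⟩) xs)
⟨⟩-concatMap f xs G = trans (pairing-expand (concatMap f xs) G)
  (trans (sum-concatMap (pairTerm G) f xs) (sum-cong xs (λ x → sym (pairing-expand (f x) G))))

⟨𝔖,⟩ : ∀ α G → ⟨ 𝔖 α , G ⟩ ≡ sumℚ (map (λ σ → sgn σ ℚ.* ⟪ shiftWord 0 α σ , G ⟫) (perms (length α)))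
⟨𝔖,⟩ α G = trans (pairing-expand (𝔖 α) G) (sum-map-∘ (pairTerm G) _ (perms (length α)))

-- An exponent r = 0 carries no part, so it removes nothing.
dropPart : ℕ → List ℕ → Maybe (List ℕ)
dropPart zero    δ       = just δ
dropPart (suc r) []      = nothing
dropPart (suc r) (d ∷ δ) = if suc r ≡ᵇ d then just δ else nothing

M-∷ : ∀ β r e → M β (r ∷ e) ≡ maybe′ (λ β' → M β' e) 0ℚ (dropPart r β)
M-∷ β       zero    e = refl
M-∷ []      (suc r) e = refl
M-∷ (d ∷ β) (suc r) e with suc r ≡ᵇ d
... | true  = refl
... | false = refl

sharedPart : ℕ → List ℕ → Maybe (ℕ × List ℕ)
sharedPart x (suc k ∷ β) = if x <ᵇ suc k then nothing else just (x ∸ suc k , β)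
sharedPart x _           = nothing

viaSharedPart : (List ℕ → List ℕ → ℚ) → ℕ → List ℕ → List ℕ → ℚ
viaSharedPart h x β δ = maybe′ (λ (r , β') → maybe′ (h β') 0ℚ (dropPart r δ)) 0ℚ (sharedPart x β)

viaSharedPart-0 : ∀ h β δ → viaSharedPart h 0 β δ ≡ 0ℚ
viaSharedPart-0 h []          δ = refl
viaSharedPart-0 h (zero ∷ β)  δ = refl
viaSharedPart-0 h (suc k ∷ β) δ = refl

-- pairingMM w β δ = ⟨H_w , M_β M_δ⟩, computed by distributing the exponent x of the first
-- variable: either all of it goes to M_δ, or the first part of β takes a share of it.
pairingMM : List ℤ → List ℕ → List ℕ → ℚ
pairingMM []             []      []      = 1ℚ
pairingMM []             []      (_ ∷ _) = 0ℚ
pairingMM []             (_ ∷ _) δ       = 0ℚ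
pairingMM (-[1+ _ ] ∷ w) β       δ       = 0ℚ
pairingMM (+ x ∷ w)      β       δ       =
  maybe′ (pairingMM w β) 0ℚ (dropPart x δ) ℚ.+ viaSharedPart (pairingMM w) x β δ

headSplit : List ℕ → List ℕ → List ℕ → ℕ → ℕ → ℚ
headSplit β δ n k r = sumℚ (map (λ p → M β (k ∷ proj₁ p) ℚ.* M δ (r ∷ proj₂ p)) (splits n))

·-∷ : ∀ (f g : Series) x n → (f · g) (x ∷ n) ≡
  sumℚ (map (λ k → sumℚ (map (λ p → f (k ∷ proj₁ p) ℚ.* g ((x ∸ k) ∷ proj₂ p)) (splits n))) (upTo (suc x)))
·-∷ f g x n = trans
  (sum-concatMap (λ p → f (proj₁ p) ℚ.* g (proj₂ p))
                 (λ k → map (λ p → (k ∷ proj₁ p , (x ∸ k) ∷ proj₂ p)) (splits n)) (upTo (suc x)))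
  (sum-cong (upTo (suc x)) (λ k → sum-map-∘ _ _ (splits n)))

module _ (n : List ℕ) (M·M≡ : ∀ β δ → (M β · M δ) n ≡ pairingMM (map +_ n) β δ) where

  headSplit-0 : ∀ β δ r → headSplit β δ n 0 r ≡ maybe′ (pairingMM (map +_ n) β) 0ℚ (dropPart r δ)
  headSplit-0 β δ r = begin
    headSplit β δ n 0 r
      ≡⟨ sum-cong (splits n) (λ p → trans (cong (M β (proj₁ p) ℚ.*_) (M-∷ δ r (proj₂ p)))
                                          (*-distribˡ-maybe′ (M β (proj₁ p)) (λ δ' → M δ' (proj₂ p)) (dropPart r δ))) ⟩
    sumℚ (map (λ p → maybe′ (λ δ' → M β (proj₁ p) ℚ.* M δ' (proj₂ p)) 0ℚ (dropPart r δ)) (splits n))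
      ≡⟨ sum-maybe′ (λ p δ' → M β (proj₁ p) ℚ.* M δ' (proj₂ p)) (dropPart r δ) (splits n) ⟩
    maybe′ (λ δ' → (M β · M δ') n) 0ℚ (dropPart r δ)
      ≡⟨ maybe′-cong (dropPart r δ) (M·M≡ β) ⟩
    maybe′ (pairingMM (map +_ n) β) 0ℚ (dropPart r δ) ∎
    where open ≡-Reasoning

  headSplit-suc : ∀ k β δ i r → headSplit (suc k ∷ β) δ n (suc i) r ≡ (if i ≡ᵇ k then headSplit β δ n 0 r else 0ℚ)
  headSplit-suc k β δ i r with i ≡ᵇ k
  ... | true  = refl
  ... | false = sum-zero (splits n) (λ p → ℚP.*-zeroˡ (M δ (r ∷ proj₂ p)))

  sum-headSplit-suc : ∀ x β δ →
    sumℚ (applyUpTo (λ i → headSplit β δ n (suc i) (x ∸ suc i)) x) ≡ viaSharedPart (pairingMM (map +_ n)) x β δ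
  sum-headSplit-suc x []          δ =
    sum-applyUpTo-zero x (λ i → sum-zero (splits n) (λ p → ℚP.*-zeroˡ (M δ ((x ∸ suc i) ∷ proj₂ p))))
  sum-headSplit-suc x (zero ∷ β)  δ =
    sum-applyUpTo-zero x (λ i → sum-zero (splits n) (λ p → ℚP.*-zeroˡ (M δ ((x ∸ suc i) ∷ proj₂ p))))
  sum-headSplit-suc x (suc k ∷ β) δ = begin
    sumℚ (applyUpTo (λ i → headSplit (suc k ∷ β) δ n (suc i) (x ∸ suc i)) x)
      ≡⟨ sum-applyUpTo-cong x (λ i → headSplit-suc k β δ i (x ∸ suc i)) ⟩
    sumℚ (applyUpTo (λ i → if i ≡ᵇ k then headSplit β δ n 0 (x ∸ suc i) else 0ℚ) x)
      ≡⟨ sum-applyUpTo-≡ᵇ x k (λ i → headSplit β δ n 0 (x ∸ suc i)) ⟩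
    (if x <ᵇ suc k then 0ℚ else headSplit β δ n 0 (x ∸ suc k))
      ≡⟨ guarded ⟩
    viaSharedPart (pairingMM (map +_ n)) x (suc k ∷ β) δ ∎
    where
    open ≡-Reasoning
    guarded : (if x <ᵇ suc k then 0ℚ else headSplit β δ n 0 (x ∸ suc k)) ≡
              viaSharedPart (pairingMM (map +_ n)) x (suc k ∷ β) δ
    guarded with x <ᵇ suc k
    ... | true  = refl
    ... | false = headSplit-0 β δ (x ∸ suc k)

M·M≡pairingMM : ∀ n β δ → (M β · M δ) n ≡ pairingMM (map +_ n) β δ
M·M≡pairingMM []      []      []      = refl
M·M≡pairingMM []      []      (_ ∷ _) = refl
M·M≡pairingMM []      (_ ∷ _) []      = refl
M·M≡pairingMM []      (_ ∷ _) (_ ∷ _) = refl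
M·M≡pairingMM (x ∷ n) β       δ       = begin
  (M β · M δ) (x ∷ n)
    ≡⟨ ·-∷ (M β) (M δ) x n ⟩
  headSplit β δ n 0 x ℚ.+ sumℚ (map (λ k → headSplit β δ n k (x ∸ k)) (applyUpTo suc x))
    ≡⟨ cong (headSplit β δ n 0 x ℚ.+_) (cong sumℚ (map-applyUpTo suc (λ k → headSplit β δ n k (x ∸ k)) x)) ⟩
  headSplit β δ n 0 x ℚ.+ sumℚ (applyUpTo (λ i → headSplit β δ n (suc i) (x ∸ suc i)) x)
    ≡⟨ cong₂ ℚ._+_ (headSplit-0 n (M·M≡pairingMM n) β δ x) (sum-headSplit-suc n (M·M≡pairingMM n) x β δ) ⟩
  pairingMM (map +_ (x ∷ n)) β δ ∎
  where open ≡-Reasoning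

pairingMM-dropZeros : ∀ n β δ → pairingMM (map +_ (dropZerosℕ n)) β δ ≡ pairingMM (map +_ n) β δ
pairingMM-dropZeros []          β δ = refl
pairingMM-dropZeros (zero ∷ n)  β δ = begin
  pairingMM (map +_ (dropZerosℕ n)) β δ ≡⟨ pairingMM-dropZeros n β δ ⟩
  pairingMM (map +_ n) β δ              ≡⟨ ℚP.+-identityʳ _ ⟨
  pairingMM (map +_ n) β δ ℚ.+ 0ℚ
    ≡⟨ cong (pairingMM (map +_ n) β δ ℚ.+_) (viaSharedPart-0 (pairingMM (map +_ n)) β δ) ⟨
  pairingMM (map +_ (zero ∷ n)) β δ     ∎
  where open ≡-Reasoning
pairingMM-dropZeros (suc m ∷ n) β δ = cong₂ ℚ._+_
  (maybe′-cong (dropPart (suc m) δ) (pairingMM-dropZeros n β))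
  (maybe′-cong (sharedPart (suc m) β) (λ (r , β') → maybe′-cong (dropPart r δ) (pairingMM-dropZeros n β')))

pairingMM-negative : ∀ w → natSeq w ≡ nothing → ∀ β δ → pairingMM w β δ ≡ 0ℚ
pairingMM-negative (-[1+ _ ] ∷ w) _ β δ = refl
pairingMM-negative (+ x ∷ w)      e β δ with natSeq w in e'
... | nothing = trans
  (cong₂ ℚ._+_ (maybe′-zero (dropPart x δ) (pairingMM-negative w e' β))
               (maybe′-zero (sharedPart x β) (λ (r , β') → maybe′-zero (dropPart r δ) (pairingMM-negative w e' β'))))
  (ℚP.+-identityˡ 0ℚ)

natSeq-just : ∀ w {v} → natSeq w ≡ just v → w ≡ map +_ v
natSeq-just []        refl = refl
natSeq-just (+ n ∷ w) e with natSeq w in e'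
natSeq-just (+ n ∷ w) refl | just u = cong (+ n ∷_) (natSeq-just w e')

⟪⟫-M·M : ∀ w β δ → ⟪ w , M β · M δ ⟫ ≡ pairingMM w β δ
⟪⟫-M·M w β δ with natSeq w in e
... | just v  = begin
  (M β · M δ) (dropZerosℕ v)              ≡⟨ M·M≡pairingMM (dropZerosℕ v) β δ ⟩
  pairingMM (map +_ (dropZerosℕ v)) β δ   ≡⟨ pairingMM-dropZeros v β δ ⟩
  pairingMM (map +_ v) β δ                ≡⟨ cong (λ w → pairingMM w β δ) (natSeq-just w e) ⟨
  pairingMM w β δ                         ∎
  where open ≡-Reasoning
... | nothing = sym (pairingMM-negative w e β δ)

mutual
  zeroPaddings : ℕ → List ℕ → List (List ℕ)
  zeroPaddings zero    []      = [] ∷ []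
  zeroPaddings zero    (_ ∷ _) = []
  zeroPaddings (suc m) β       = map (0 ∷_) (zeroPaddings m β) ++ headedPaddings m β

  headedPaddings : ℕ → List ℕ → List (List ℕ)
  headedPaddings m (suc k ∷ β) = map (suc k ∷_) (zeroPaddings m β)
  headedPaddings m _           = []

∈-zeroPaddings⁻ : ∀ m β {b} → b ∈ zeroPaddings m β → length b ≡ m × dropZerosℕ b ≡ β
∈-zeroPaddings⁻ zero    []      (here refl) = refl , refl
∈-zeroPaddings⁻ (suc m) β       p with ∈-++⁻ (map (0 ∷_) (zeroPaddings m β)) p
... | inj₁ q with ∈-map⁻ (0 ∷_) q
...   | _ , q' , refl = Product.map₁ (cong suc) (∈-zeroPaddings⁻ m β q')
∈-zeroPaddings⁻ (suc m) (suc k ∷ β) p | inj₂ q with ∈-map⁻ (suc k ∷_) q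
...   | _ , q' , refl = Product.map (cong suc) (cong (suc k ∷_)) (∈-zeroPaddings⁻ m β q')

∈-zeroPaddings⁺ : ∀ b → b ∈ zeroPaddings (length b) (dropZerosℕ b)
∈-zeroPaddings⁺ []          = here refl
∈-zeroPaddings⁺ (zero ∷ b)  = ∈-++⁺ˡ (∈-map⁺ (0 ∷_) (∈-zeroPaddings⁺ b))
∈-zeroPaddings⁺ (suc j ∷ b) =
  ∈-++⁺ʳ (map (0 ∷_) (zeroPaddings (length b) (suc j ∷ dropZerosℕ b))) (∈-map⁺ (suc j ∷_) (∈-zeroPaddings⁺ b))

zeroPaddings-unique : ∀ m β → Unique (zeroPaddings m β)
zeroPaddings-unique zero    []      = [] ∷ []
zeroPaddings-unique zero    (_ ∷ _) = []
zeroPaddings-unique (suc m) β       =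
  Unique.++⁺ (Unique.map⁺ ∷-injectiveʳ (zeroPaddings-unique m β)) (headed β) (disjoint β)
  where
  headed : ∀ β → Unique (headedPaddings m β)
  headed []          = []
  headed (zero ∷ β)  = []
  headed (suc k ∷ β) = Unique.map⁺ ∷-injectiveʳ (zeroPaddings-unique m β)

  disjoint : ∀ β → Disjoint (map (0 ∷_) (zeroPaddings m β)) (headedPaddings m β)
  disjoint (suc k ∷ β) (p , q) with ∈-map⁻ (0 ∷_) p | ∈-map⁻ (suc k ∷_) q
  ... | _ , _ , refl | _ , _ , ()

length-zeroPaddings : ∀ m β → All (λ b → length b ≡ m) (zeroPaddings m β)
length-zeroPaddings m β = All.tabulate (proj₁ ∘ ∈-zeroPaddings⁻ m β)

⟪⟫-M-∷ : ∀ r u δ → ⟪ + r ∷ u , M δ ⟫ ≡ maybe′ (λ δ' → ⟪ u , M δ' ⟫) 0ℚ (dropPart r δ)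
⟪⟫-M-∷ r u δ with natSeq u
... | just v  = trans (M-dropZerosℕ δ (r ∷ v))
                      (trans (M-∷ δ r v) (maybe′-cong (dropPart r δ) (λ δ' → sym (M-dropZerosℕ δ' v))))
... | nothing = sym (maybe′-zero (dropPart r δ) (λ _ → refl))

-- The entry + x ℤ.- + suc k of a difference computes to x ℤ.⊖ suc k.
⟪⟫-⊖-∷ : ∀ x k u G → ⟪ (x ℤ.⊖ suc k) ∷ u , G ⟫ ≡ (if x <ᵇ suc k then 0ℚ else ⟪ + (x ∸ suc k) ∷ u , G ⟫)
⟪⟫-⊖-∷ zero    k       u G = refl
⟪⟫-⊖-∷ (suc x) zero    u G = refl
⟪⟫-⊖-∷ (suc x) (suc k) u G =
  trans (cong (λ z → ⟪ z ∷ u , G ⟫) (ℤP.[1+m]⊖[1+n]≡m⊖n x (suc k))) (⟪⟫-⊖-∷ x k u G)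

module _ (w : List ℤ)
         (sum≡ : ∀ β δ → sumℚ (map (λ b → ⟪ w ⊖ map +_ b , M δ ⟫) (zeroPaddings (length w) β)) ≡ pairingMM w β δ)
         where

  sum-zeroPaddings-dropPart : ∀ r β δ →
    sumℚ (map (λ b → ⟪ + r ∷ (w ⊖ map +_ b) , M δ ⟫) (zeroPaddings (length w) β)) ≡
    maybe′ (pairingMM w β) 0ℚ (dropPart r δ)
  sum-zeroPaddings-dropPart r β δ = begin
    sumℚ (map (λ b → ⟪ + r ∷ (w ⊖ map +_ b) , M δ ⟫) B)
      ≡⟨ sum-cong B (λ b → ⟪⟫-M-∷ r (w ⊖ map +_ b) δ) ⟩
    sumℚ (map (λ b → maybe′ (λ δ' → ⟪ w ⊖ map +_ b , M δ' ⟫) 0ℚ (dropPart r δ)) B)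
      ≡⟨ sum-maybe′ (λ b δ' → ⟪ w ⊖ map +_ b , M δ' ⟫) (dropPart r δ) B ⟩
    maybe′ (λ δ' → sumℚ (map (λ b → ⟪ w ⊖ map +_ b , M δ' ⟫) B)) 0ℚ (dropPart r δ)
      ≡⟨ maybe′-cong (dropPart r δ) (sum≡ β) ⟩
    maybe′ (pairingMM w β) 0ℚ (dropPart r δ) ∎
    where
    open ≡-Reasoning
    B = zeroPaddings (length w) β

  sum-headedPaddings : ∀ x β δ →
    sumℚ (map (λ b → ⟪ (+ x ∷ w) ⊖ map +_ b , M δ ⟫) (headedPaddings (length w) β)) ≡ viaSharedPart (pairingMM w) x β δ
  sum-headedPaddings x []          δ = refl
  sum-headedPaddings x (zero ∷ β)  δ = refl
  sum-headedPaddings x (suc k ∷ β) δ =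
    trans (sum-map-∘ _ _ B) (trans (sum-cong B (λ b → ⟪⟫-⊖-∷ x k (w ⊖ map +_ b) (M δ))) guarded)
    where
    B = zeroPaddings (length w) β
    guarded : sumℚ (map (λ b → if x <ᵇ suc k then 0ℚ else ⟪ + (x ∸ suc k) ∷ (w ⊖ map +_ b) , M δ ⟫) B) ≡
              viaSharedPart (pairingMM w) x (suc k ∷ β) δ
    guarded with x <ᵇ suc k
    ... | true  = sum-zero B (λ _ → refl)
    ... | false = sum-zeroPaddings-dropPart (x ∸ suc k) β δ

sum-zeroPaddings : ∀ w β δ →
  sumℚ (map (λ b → ⟪ w ⊖ map +_ b , M δ ⟫) (zeroPaddings (length w) β)) ≡ pairingMM w β δ
sum-zeroPaddings []             []      []      = refl
sum-zeroPaddings []             []      (_ ∷ _) = refl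
sum-zeroPaddings []             (_ ∷ _) δ       = refl
sum-zeroPaddings (-[1+ j ] ∷ w) β       δ       =
  trans (sum-cong-All (All.map (λ {b} → negativeHead b) (length-zeroPaddings (suc (length w)) β)))
        (sum-zero (zeroPaddings (suc (length w)) β) (λ _ → refl))
  where
  negativeHead : ∀ b → length b ≡ suc (length w) → ⟪ (-[1+ j ] ∷ w) ⊖ map +_ b , M δ ⟫ ≡ 0ℚ
  negativeHead (zero  ∷ b) _ = refl
  negativeHead (suc c ∷ b) _ = refl
sum-zeroPaddings (+ x ∷ w)      β       δ       = begin
  sumℚ (map (λ b → ⟪ (+ x ∷ w) ⊖ map +_ b , M δ ⟫) (map (0 ∷_) B ++ headedPaddings (length w) β))
    ≡⟨ sum-map-++ _ (map (0 ∷_) B) (headedPaddings (length w) β) ⟩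
  sumℚ (map (λ b → ⟪ (+ x ∷ w) ⊖ map +_ b , M δ ⟫) (map (0 ∷_) B)) ℚ.+ headed
    ≡⟨ cong (ℚ._+ headed) (sum-map-∘ _ _ B) ⟩
  sumℚ (map (λ b → ⟪ + (x ℕ.+ 0) ∷ (w ⊖ map +_ b) , M δ ⟫) B) ℚ.+ headed
    ≡⟨ cong (λ y → sumℚ (map (λ b → ⟪ + y ∷ (w ⊖ map +_ b) , M δ ⟫) B) ℚ.+ headed) (ℕP.+-identityʳ x) ⟩
  sumℚ (map (λ b → ⟪ + x ∷ (w ⊖ map +_ b) , M δ ⟫) B) ℚ.+ headed
    ≡⟨ cong₂ ℚ._+_ (sum-zeroPaddings-dropPart w (sum-zeroPaddings w) x β δ)
                   (sum-headedPaddings w (sum-zeroPaddings w) x β δ) ⟩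
  pairingMM (+ x ∷ w) β δ ∎
  where
  open ≡-Reasoning
  B = zeroPaddings (length w) β
  headed = sumℚ (map (λ b → ⟪ (+ x ∷ w) ⊖ map +_ b , M δ ⟫) (headedPaddings (length w) β))

M⊥-word : ∀ w β δ →
  ⟪ w , M β · M δ ⟫ ≡ sumℚ (map (λ b → ⟪ w ⊖ map +_ b , M δ ⟫) (zeroPaddings (length w) β))
M⊥-word w β δ = trans (⟪⟫-M·M w β δ) (sym (sum-zeroPaddings w β δ))

shiftWord-⊖ : ∀ i α b σ → shiftWord i (α ⊖ b) σ ≡ shiftWord i α σ ⊖ b
shiftWord-⊖ i []      b       σ       = refl
shiftWord-⊖ i (a ∷ α) []      []      = refl
shiftWord-⊖ i (a ∷ α) []      (s ∷ σ) = refl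
shiftWord-⊖ i (a ∷ α) (c ∷ b) []      = refl
shiftWord-⊖ i (a ∷ α) (c ∷ b) (s ∷ σ) = cong₂ _∷_ (shift-sub a c (+ s) (+ i)) (shiftWord-⊖ (suc i) α b σ)
  where
  shift-sub : ∀ (a c s i : ℤ) → (a ℤ.- c) ℤ.+ s ℤ.- i ≡ (a ℤ.+ s ℤ.- i) ℤ.- c
  shift-sub = solve-∀

length-shiftWord : ∀ i α σ → length σ ≡ length α → length (shiftWord i α σ) ≡ length α
length-shiftWord i []      []      e = refl
length-shiftWord i (a ∷ α) (s ∷ σ) e = cong suc (length-shiftWord (suc i) α σ (ℕP.suc-injective e))

length-insertAll : ∀ x ys → All (λ zs → length zs ≡ suc (length ys)) (insertAll x ys)
length-insertAll x []       = refl ∷ []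
length-insertAll x (y ∷ ys) = refl ∷ AllP.map⁺ (All.map (cong suc) (length-insertAll x ys))

length-perms : ∀ m → All (λ σ → length σ ≡ m) (perms m)
length-perms zero    = refl ∷ []
length-perms (suc m) = AllP.concat⁺ (AllP.map⁺ (All.map
  (λ {σ} σ≡m → All.map (λ e → trans e (cong suc σ≡m)) (length-insertAll m σ)) (length-perms m)))

length-⊖ : ∀ α γ → length γ ≡ length α → length (α ⊖ γ) ≡ length α
length-⊖ []      []      e = refl
length-⊖ (a ∷ α) (g ∷ γ) e = cong suc (length-⊖ α γ (ℕP.suc-injective e))

M⊥-𝔖 : ∀ α β δ → ⟨ 𝔖 α , M β · M δ ⟩ ≡
  sumℚ (map (λ b → ⟨ 𝔖 (α ⊖ map +_ b) , M δ ⟩) (zeroPaddings (length α) β))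
M⊥-𝔖 α β δ = begin
  ⟨ 𝔖 α , M β · M δ ⟩
    ≡⟨ ⟨𝔖,⟩ α (M β · M δ) ⟩
  sumℚ (map (λ σ → sgn σ ℚ.* ⟪ shiftWord 0 α σ , M β · M δ ⟫) (perms m))
    ≡⟨ sum-cong-All (All.map (λ {σ} → expand σ) (length-perms m)) ⟩
  sumℚ (map (λ σ → sumℚ (map (term σ) B)) (perms m))
    ≡⟨ sum-swap term (perms m) B ⟩
  sumℚ (map (λ b → sumℚ (map (λ σ → term σ b) (perms m))) B)
    ≡⟨ sum-cong-All (All.map (λ {b} b≡m → sym (collect b b≡m)) (length-zeroPaddings m β)) ⟩
  sumℚ (map (λ b → ⟨ 𝔖 (α ⊖ map +_ b) , M δ ⟩) B) ∎
  where
  open ≡-Reasoning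
  m = length α
  B = zeroPaddings m β
  term : List ℕ → List ℕ → ℚ
  term σ b = sgn σ ℚ.* ⟪ shiftWord 0 (α ⊖ map +_ b) σ , M δ ⟫

  expand : ∀ σ → length σ ≡ m →
    sgn σ ℚ.* ⟪ shiftWord 0 α σ , M β · M δ ⟫ ≡ sumℚ (map (term σ) B)
  expand σ σ≡m = begin
    sgn σ ℚ.* ⟪ shiftWord 0 α σ , M β · M δ ⟫
      ≡⟨ cong (sgn σ ℚ.*_) (M⊥-word (shiftWord 0 α σ) β δ) ⟩
    sgn σ ℚ.* sumℚ (map (λ b → ⟪ shiftWord 0 α σ ⊖ map +_ b , M δ ⟫) (zeroPaddings (length (shiftWord 0 α σ)) β))
      ≡⟨ cong (λ k → sgn σ ℚ.* sumℚ (map (λ b → ⟪ shiftWord 0 α σ ⊖ map +_ b , M δ ⟫) (zeroPaddings k β)))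
              (length-shiftWord 0 α σ σ≡m) ⟩
    sgn σ ℚ.* sumℚ (map (λ b → ⟪ shiftWord 0 α σ ⊖ map +_ b , M δ ⟫) B)
      ≡⟨ *-distribˡ-sum (sgn σ) _ B ⟩
    sumℚ (map (λ b → sgn σ ℚ.* ⟪ shiftWord 0 α σ ⊖ map +_ b , M δ ⟫) B)
      ≡⟨ sum-cong B (λ b → cong (λ w → sgn σ ℚ.* ⟪ w , M δ ⟫) (sym (shiftWord-⊖ 0 α (map +_ b) σ))) ⟩
    sumℚ (map (term σ) B) ∎

  collect : ∀ b → length b ≡ m → ⟨ 𝔖 (α ⊖ map +_ b) , M δ ⟩ ≡ sumℚ (map (λ σ → term σ b) (perms m))
  collect b b≡m = trans (⟨𝔖,⟩ (α ⊖ map +_ b) (M δ))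
    (cong (λ k → sumℚ (map (λ σ → term σ b) (perms k))) (length-⊖ α (map +_ b) (trans (length-map +_ b) b≡m)))

⊖-involutive : ∀ α γ → length γ ≡ length α → α ⊖ (α ⊖ γ) ≡ γ
⊖-involutive []      []      e = refl
⊖-involutive (a ∷ α) (g ∷ γ) e = cong₂ _∷_ (sub-sub a g) (⊖-involutive α γ (ℕP.suc-injective e))
  where
  sub-sub : ∀ (a g : ℤ) → a ℤ.- (a ℤ.- g) ≡ g
  sub-sub = solve-∀

dropZerosℤ-map : ∀ b → dropZerosℤ (map +_ b) ≡ map +_ (dropZerosℕ b)
dropZerosℤ-map []          = refl
dropZerosℤ-map (zero ∷ b)  = dropZerosℤ-map b
dropZerosℤ-map (suc n ∷ b) = cong (+ suc n ∷_) (dropZerosℤ-map b)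

dropZerosℤ≡map⇒nonNegative : ∀ u β → dropZerosℤ u ≡ map +_ β → ∃ λ b → u ≡ map +_ b
dropZerosℤ≡map⇒nonNegative []            β       e = [] , refl
dropZerosℤ≡map⇒nonNegative (+ zero ∷ u)  β       e =
  Product.map (0 ∷_) (cong (+ 0 ∷_)) (dropZerosℤ≡map⇒nonNegative u β e)
dropZerosℤ≡map⇒nonNegative (+ suc n ∷ u) (_ ∷ β) e =
  Product.map (suc n ∷_) (cong (+ suc n ∷_)) (dropZerosℤ≡map⇒nonNegative u β (∷-injectiveʳ e))
dropZerosℤ≡map⇒nonNegative (-[1+ _ ] ∷ u) []      ()
dropZerosℤ≡map⇒nonNegative (-[1+ _ ] ∷ u) (_ ∷ β) ()

differences : List ℤ → List ℕ → List (List ℤ)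
differences α β = map (λ b → α ⊖ map +_ b) (zeroPaddings (length α) β)

∈-differences : ∀ α β {γ} → γ ∈ differences α β ⇔ (length γ ≡ length α × dropZerosℤ (α ⊖ γ) ≡ map +_ β)
∈-differences α β {γ} = mk⇔ to from
  where
  to : γ ∈ differences α β → length γ ≡ length α × dropZerosℤ (α ⊖ γ) ≡ map +_ β
  to p with ∈-map⁻ (λ b → α ⊖ map +_ b) p
  ... | b , q , refl with ∈-zeroPaddings⁻ (length α) β q
  ...   | b≡m , b→β = length-⊖ α (map +_ b) +b≡m ,
          trans (cong dropZerosℤ (⊖-involutive α (map +_ b) +b≡m)) (trans (dropZerosℤ-map b) (cong (map +_) b→β))
    where
    +b≡m = trans (length-map +_ b) b≡m

  from : length γ ≡ length α × dropZerosℤ (α ⊖ γ) ≡ map +_ β → γ ∈ differences α β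
  from (γ≡m , α-γ→β) with dropZerosℤ≡map⇒nonNegative (α ⊖ γ) β α-γ→β
  ... | b , α-γ≡b = subst (_∈ differences α β) γ≡α-b (∈-map⁺ (λ b → α ⊖ map +_ b) b∈B)
    where
    γ≡α-b : α ⊖ map +_ b ≡ γ
    γ≡α-b = trans (cong (α ⊖_) (sym α-γ≡b)) (⊖-involutive α γ γ≡m)
    b≡m : length b ≡ length α
    b≡m = trans (sym (length-map +_ b)) (trans (cong length (sym α-γ≡b)) (length-⊖ α γ γ≡m))
    b→β : dropZerosℕ b ≡ β
    b→β = map-injective ℤP.+-injective (trans (sym (dropZerosℤ-map b)) (trans (cong dropZerosℤ (sym α-γ≡b)) α-γ→β))
    b∈B : b ∈ zeroPaddings (length α) β
    b∈B = subst₂ (λ m β → b ∈ zeroPaddings m β) b≡m b→β (∈-zeroPaddings⁺ b)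

differences-unique : ∀ α β → Unique (differences α β)
differences-unique α β = Unique.map⁻ (subst Unique (sym involution) naturals-unique)
  where
  B = zeroPaddings (length α) β
  naturals-unique : Unique (map (map +_) B)
  naturals-unique = Unique.map⁺ (map-injective ℤP.+-injective) (zeroPaddings-unique (length α) β)
  involution : map (α ⊖_) (differences α β) ≡ map (map +_) B
  involution = trans (sym (map-∘ B)) (map-cong-local
    (All.map (λ {b} b≡m → ⊖-involutive α (map +_ b) (trans (length-map +_ b) b≡m)) (length-zeroPaddings (length α) β)))

theorem6p1 : (α : List ℤ) (β : List ℕ) → IsComposition β →
    (Γ : List (List ℤ)) → Unique Γ →
    (∀ γ → γ ∈ Γ ⇔ (length γ ≡ length α × dropZerosℤ (α ⊖ γ) ≡ map +_ β)) →
    ∀ δ → IsComposition δ → perpCoeff (M β) (𝔖 α) δ ≡ coeffH (sum𝔖 Γ) δ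
theorem6p1 α β _ Γ Γ! Γ-spec δ _ = begin
  perpCoeff (M β) (𝔖 α) δ                                ≡⟨ M⊥-𝔖 α β δ ⟩
  sumℚ (map (λ b → ⟨ 𝔖 (α ⊖ map +_ b) , M δ ⟩) B)        ≡⟨ sum-map-∘ _ _ B ⟨
  sumℚ (map (λ γ → ⟨ 𝔖 γ , M δ ⟩) (differences α β))
    ≡⟨ sum-unique-set (λ γ → ⟨ 𝔖 γ , M δ ⟩) (differences-unique α β) Γ!
                      (λ {γ} → ⇔.trans (∈-differences α β) (⇔.sym (Γ-spec γ))) ⟩
  sumℚ (map (λ γ → ⟨ 𝔖 γ , M δ ⟩) Γ)                     ≡⟨ ⟨⟩-concatMap 𝔖 Γ (M δ) ⟨
  ⟨ sum𝔖 Γ , M δ ⟩                                       ≡⟨ coeffH≡⟨⟩M (sum𝔖 Γ) δ ⟨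
  coeffH (sum𝔖 Γ) δ                                      ∎
  where
  open ≡-Reasoning
  B = zeroPaddings (length α) β
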